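{- For a non-empty closed Boolean equation system $\mathcal{E}$ in standard recursive form, the structure graph $\mathcal{G}_{\mathcal{E}}$ is isomorphic to its dependency graph.
   Context: A Boolean equation system in standard recursive form (SRF) is a sequence of equations $(\sigma X = f)$ with $\sigma\in\{\mu,\nu\}$ and $f$ of the form $X$, $\bigwedge F$ or $\bigvee F$ for a non-empty set $F$ of proposition variables; it is closed if every variable occurring in a right-hand side is bound by some equation. $\mathsf{rank}(X)$ counts fixed-point alternations up to the equation of $X$ (odd iff that equation is a $\mu$-equation). The dependency graph of such $\mathcal{E}$ is $\langle V,\to,r,l\rangle$ with $V$ the set of bound variables, $X\to Y$ iff $Y$ occurs in the right-hand side of $X$'s equation, $r(X)=\mathsf{rank}(X)$, and $l(X)\in\{\wedge,\vee,\bot\}$ the Boolean operator of $X$'s right-hand side ($\bot$ if none). The structure graph $\mathcal{G}_{\mathcal{E}}=\langle T,X_0,\to,d\rangle$ (with $X_0$ the first bound variable of $\mathcal{E}$) is generated by the rules: $X$ is decorated $\blacktriangle$ if $\sigma X=\bigwedge F\in\mathcal{E}$, decorated $\blacktriangledown$ if $\sigma X=\bigvee F\in\mathcal{E}$, $X\to Y$ if $\sigma X=f\in\mathcal{E}$ and $Y$ occurs in $f$, $X$ is decorated with rank $n$ if $X$ is bound and $\mathsf{rank}(X)=n$; and $\bigwedge F$ is decorated $\blacktriangle$, $\bigvee F$ decorated $\blacktriangledown$, with $\bigwedge F\to X$ and $\bigvee F\to X$ for $X\in F$.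
   Formalization: The vertex set of $\mathcal{G}_{\mathcal{E}}$ consists of all terms reachable from some bound variable, not only from $X_0$, and $\mathcal{E}$ is also assumed to bind each variable at most once. Each condition added here is assumed in the paper as well or is needed for the statement above to hold. -}

module Defs where

open import Data.Nat using (ℕ; zero; suc; _≡ᵇ_)
open import Data.Bool using (Bool; true; false; if_then_else_)
open import Data.List using (List; []; _∷_; map)
open import Data.List.NonEmpty using (List⁺; toList)
open import Data.List.Membership.Propositional using (_∈_)
open import Data.List.Relation.Unary.Unique.Propositional using (Unique)
open import Data.Maybe using (Maybe; just; nothing)
open import Data.Product using (Σ; _×_; ∃; ∃-syntax)
open import Relation.Binary.PropositionalEquality using (_≡_; _≢_)
open import Relation.Binary.Construct.Closure.ReflexiveTransitive using (Star)
open import Function.Bundles using (_⇔_)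

data Fix : Set where
  μ ν : Fix

-- Right-hand sides in SRF: X, ⋀F, ⋁F with F a non-empty (finite) set,
-- represented as a non-empty list (only membership matters).
data RHS : Set where
  var : ℕ → RHS
  conj : List⁺ ℕ → RHS
  disj : List⁺ ℕ → RHS

record Equation : Set where
  constructor _⦅_≔_⦆
  field
    σ   : Fix
    lhs : ℕ
    rhs : RHS
open Equation public

BES : Set
BES = List Equation

WellFormed : BES → Set
WellFormed E = Unique (map lhs E)

Bound : BES → ℕ → Set
Bound E X = X ∈ map lhs E

Occurs : ℕ → RHS → Set
Occurs Y (var X) = Y ≡ X
Occurs Y (conj F) = Y ∈ toList F
Occurs Y (disj F) = Y ∈ toList F

Closed : BES → Set
Closed E = ∀ {e} → e ∈ E → ∀ Y → Occurs Y (rhs e) → Bound E Y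

-- rank: number of fixed-point alternations up to the equation of X,
-- scanning from the start; odd iff the equation is a μ-equation.

odd? : ℕ → Bool
odd? zero = false
odd? (suc n) with odd? n
... | true = false
... | false = true

step : ℕ → Fix → ℕ
step r μ = if odd? r then r else suc r
step r ν = if odd? r then suc r else r

rankFrom : ℕ → BES → ℕ → ℕ
rankFrom r [] X = 0
rankFrom r (e ∷ E) X =
  if lhs e ≡ᵇ X then step r (σ e) else rankFrom (step r (σ e)) E X

rank : BES → ℕ → ℕ
rank E X = rankFrom 0 E X

-- the (first, hence unique for well-formed E) equation binding X
eqnOf : BES → ℕ → Maybe Equation
eqnOf [] X = nothing
eqnOf (e ∷ E) X = if lhs e ≡ᵇ X then just e else eqnOf E X

data Label : Set where
  ∧ₗ ∨ₗ ⊥ₗ : Label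

labelOf : Maybe Equation → Label
labelOf (just (_ ⦅ _ ≔ conj _ ⦆)) = ∧ₗ
labelOf (just (_ ⦅ _ ≔ disj _ ⦆)) = ∨ₗ
labelOf _ = ⊥ₗ

module DependencyGraph (E : BES) where
  V : ℕ → Set
  V = Bound E

  _⇒_ : ℕ → ℕ → Set
  X ⇒ Y = Σ Equation λ e → e ∈ E × lhs e ≡ X × Occurs Y (rhs e)

  r : ℕ → ℕ
  r = rank E

  l : ℕ → Label
  l X = labelOf (eqnOf E X)

data Term : Set where
  ′_ : ℕ → Term
  ⋀_ : List⁺ ℕ → Term
  ⋁_ : List⁺ ℕ → Term

data Deco : Set where
  ▲ ▼ : Deco
  rk : ℕ → Deco

firstVar : BES → Maybe ℕ
firstVar [] = nothing
firstVar (e ∷ _) = just (lhs e)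

module StructureGraph (E : BES) where
  data _⟶_ : Term → Term → Set where
    eqn-step : ∀ {e Y} → e ∈ E → Occurs Y (rhs e) → (′ lhs e) ⟶ (′ Y)
    conj-step : ∀ {F Y} → Y ∈ toList F → (⋀ F) ⟶ (′ Y)
    disj-step : ∀ {F Y} → Y ∈ toList F → (⋁ F) ⟶ (′ Y)

  data d : Term → Deco → Set where
    eqn-▲ : ∀ {e F} → e ∈ E → rhs e ≡ conj F → d (′ lhs e) ▲
    eqn-▼ : ∀ {e F} → e ∈ E → rhs e ≡ disj F → d (′ lhs e) ▼
    eqn-rk : ∀ {X} → Bound E X → d (′ X) (rk (rank E X))
    conj-▲ : ∀ {F} → d (⋀ F) ▲
    disj-▼ : ∀ {F} → d (⋁ F) ▼

  T : Term → Set
  T t = ∃[ X ] (Bound E X × Star _⟶_ (′ X) t)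

  root : Maybe ℕ
  root = firstVar E

record StructDepIso (E : BES) : Set where
  open StructureGraph E
  open DependencyGraph E
  field
    φ     : Term → ℕ
    into  : ∀ {t} → T t → V (φ t)
    inj   : ∀ {t u} → T t → T u → φ t ≡ φ u → t ≡ u
    surj  : ∀ {X} → V X → ∃[ t ] (T t × φ t ≡ X)
    edges : ∀ {t u} → T t → T u → (t ⟶ u) ⇔ (φ t ⇒ φ u)
    deco▲ : ∀ {t} → T t → d t ▲ ⇔ (l (φ t) ≡ ∧ₗ)
    deco▼ : ∀ {t} → T t → d t ▼ ⇔ (l (φ t) ≡ ∨ₗ)
    decoRk : ∀ {t} → T t → ∀ n → d t (rk n) ⇔ (r (φ t) ≡ n)

module Submission where

-- The rules for the structure graph only produce edges ′ X ⟶ ′ Y from a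
-- bound variable X to a variable Y occurring in X's equation; the rules for
-- ⋀F and ⋁F are never triggered from a variable.  So when E is closed,
-- every term reachable from a bound variable is again a bound variable
-- (`reachable-bound`), and T consists of exactly the terms ′ X with X bound.
-- The isomorphism is therefore φ (′ X) = X, and it suffices to compare the
-- two graphs on bound variables (`T-elim` lifts such comparisons to T):
--   * edges agree by definition (`edge-iff`);
--   * the rank decoration is rank E X by definition (`rank-iff`);
--   * the ▲/▼ decorations agree with the label l, because in a well-formed
--     system `eqnOf E X` returns exactly the equation binding X
--     (`eqnOf-sound`, `eqnOf-complete`, then `conj-iff`, `disj-iff`).

open import Defs
open import Data.Nat using (ℕ; _≡ᵇ_)
open import Data.Nat.Properties using (≡ᵇ⇒≡; ≡⇒≡ᵇ)
open import Data.Bool using (true; false)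
open import Data.Bool.Properties using (T-≡)
open import Data.List using ([]; _∷_)
open import Data.List.Relation.Unary.Any using (here; there)
open import Data.List.Relation.Unary.All using (lookup)
open import Data.List.Relation.Unary.AllPairs using (_∷_)
open import Data.List.Membership.Propositional using (_∈_)
open import Data.List.Membership.Propositional.Properties using (∈-map⁺)
open import Data.Maybe using (just; nothing)
open import Data.Product using (_×_; _,_; ∃-syntax)
open import Data.Empty using (⊥-elim)
open import Function using (id)
open import Function.Bundles using (_⇔_; mk⇔; Equivalence)
open import Relation.Binary.PropositionalEquality using (_≡_; _≢_; refl; sym; trans; cong)
open import Relation.Binary.Construct.Closure.ReflexiveTransitive using (Star; ε; _◅_)

≡ᵇ-true⇒≡ : ∀ {m n} → (m ≡ᵇ n) ≡ true → m ≡ n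
≡ᵇ-true⇒≡ {m} {n} b = ≡ᵇ⇒≡ m n (Equivalence.from T-≡ b)

≡ᵇ-refl : ∀ m → (m ≡ᵇ m) ≡ true
≡ᵇ-refl m = Equivalence.to T-≡ (≡⇒≡ᵇ m m refl)

eqnOf-sound : ∀ E {X e} → eqnOf E X ≡ just e → e ∈ E × lhs e ≡ X
eqnOf-sound (e′ ∷ E) {X} found with lhs e′ ≡ᵇ X in b
eqnOf-sound (e′ ∷ E) refl | true  = here refl , ≡ᵇ-true⇒≡ b
eqnOf-sound (e′ ∷ E) found | false with eqnOf-sound E found
... | e∈E , bindsX = there e∈E , bindsX

-- In a well-formed system each equation is the one `eqnOf` finds for its
-- left-hand side: no earlier equation binds the same variable.
eqnOf-complete : ∀ E → WellFormed E → ∀ {e} → e ∈ E → eqnOf E (lhs e) ≡ just e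
eqnOf-complete (e′ ∷ E) wf (here refl) rewrite ≡ᵇ-refl (lhs e′) = refl
eqnOf-complete (e′ ∷ E) (fresh ∷ wf) {e} (there e∈E) with lhs e′ ≡ᵇ lhs e in b
... | true  = ⊥-elim (lookup fresh (∈-map⁺ lhs e∈E) (≡ᵇ-true⇒≡ b))
... | false = eqnOf-complete E wf e∈E

conj-label : ∀ e → labelOf (just e) ≡ ∧ₗ ⇔ (∃[ F ] rhs e ≡ conj F)
conj-label e = mk⇔ (to e) λ { (F , eq) → from e eq }
  where
  to : ∀ e → labelOf (just e) ≡ ∧ₗ → ∃[ F ] rhs e ≡ conj F
  to (_ ⦅ _ ≔ conj F ⦆) refl = F , refl
  to (_ ⦅ _ ≔ var _ ⦆) ()
  to (_ ⦅ _ ≔ disj _ ⦆) ()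
  from : ∀ e {F} → rhs e ≡ conj F → labelOf (just e) ≡ ∧ₗ
  from (_ ⦅ _ ≔ _ ⦆) refl = refl

disj-label : ∀ e → labelOf (just e) ≡ ∨ₗ ⇔ (∃[ F ] rhs e ≡ disj F)
disj-label e = mk⇔ (to e) λ { (F , eq) → from e eq }
  where
  to : ∀ e → labelOf (just e) ≡ ∨ₗ → ∃[ F ] rhs e ≡ disj F
  to (_ ⦅ _ ≔ disj F ⦆) refl = F , refl
  to (_ ⦅ _ ≔ var _ ⦆) ()
  to (_ ⦅ _ ≔ conj _ ⦆) ()
  from : ∀ e {F} → rhs e ≡ disj F → labelOf (just e) ≡ ∨ₗ
  from (_ ⦅ _ ≔ _ ⦆) refl = refl

module _ (E : BES) where
  open StructureGraph E
  open DependencyGraph E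

  label-of-equation : WellFormed E → ∀ {e} → e ∈ E → l (lhs e) ≡ labelOf (just e)
  label-of-equation wf e∈E = cong labelOf (eqnOf-complete E wf e∈E)

  equation-of-label : ∀ {X k} → l X ≡ k → k ≢ ⊥ₗ →
                      ∃[ e ] (e ∈ E × lhs e ≡ X × labelOf (just e) ≡ k)
  equation-of-label {X} lX≡k k≢⊥ with eqnOf E X in found
  ... | nothing = ⊥-elim (k≢⊥ (sym lX≡k))
  ... | just e with eqnOf-sound E found
  ...   | e∈E , bindsX = e , e∈E , bindsX , lX≡k

  reachable-bound : Closed E → ∀ {X t} → Bound E X → Star _⟶_ (′ X) t →
                    ∃[ Y ] (t ≡ ′ Y × Bound E Y)
  reachable-bound cl {X} bound ε = X , refl , bound
  reachable-bound cl bound (eqn-step e∈E occurs ◅ path) =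
    reachable-bound cl (cl e∈E _ occurs) path

  T-elim : Closed E → (P : Term → Set) → (∀ {X} → Bound E X → P (′ X)) →
           ∀ {t} → T t → P t
  T-elim cl P onBound (X , bound , path) with reachable-bound cl bound path
  ... | Y , refl , boundY = onBound boundY

  edge-iff : ∀ {X Y} → (′ X) ⟶ (′ Y) ⇔ X ⇒ Y
  edge-iff = mk⇔ (λ { (eqn-step {e} e∈E occurs) → e , e∈E , refl , occurs })
                 (λ { (e , e∈E , refl , occurs) → eqn-step e∈E occurs })

  conj-iff : WellFormed E → ∀ {X} → d (′ X) ▲ ⇔ l X ≡ ∧ₗ
  conj-iff wf = mk⇔ to from
    where
    to : ∀ {X} → d (′ X) ▲ → l X ≡ ∧ₗ
    to (eqn-▲ {e} e∈E isConj) =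
      trans (label-of-equation wf e∈E) (Equivalence.from (conj-label e) (_ , isConj))
    from : ∀ {X} → l X ≡ ∧ₗ → d (′ X) ▲
    from lX≡∧ with equation-of-label lX≡∧ (λ ())
    ... | e , e∈E , refl , labelled with Equivalence.to (conj-label e) labelled
    ...   | _ , isConj = eqn-▲ e∈E isConj

  disj-iff : WellFormed E → ∀ {X} → d (′ X) ▼ ⇔ l X ≡ ∨ₗ
  disj-iff wf = mk⇔ to from
    where
    to : ∀ {X} → d (′ X) ▼ → l X ≡ ∨ₗ
    to (eqn-▼ {e} e∈E isDisj) =
      trans (label-of-equation wf e∈E) (Equivalence.from (disj-label e) (_ , isDisj))
    from : ∀ {X} → l X ≡ ∨ₗ → d (′ X) ▼
    from lX≡∨ with equation-of-label lX≡∨ (λ ())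
    ... | e , e∈E , refl , labelled with Equivalence.to (disj-label e) labelled
    ...   | _ , isDisj = eqn-▼ e∈E isDisj

  rank-iff : ∀ {X} → Bound E X → ∀ n → d (′ X) (rk n) ⇔ r X ≡ n
  rank-iff bound n = mk⇔ (λ { (eqn-rk _) → refl }) (λ { refl → eqn-rk bound })

varOf : Term → ℕ
varOf (′ X) = X
varOf _     = 0

mainTheorem5 : (E : BES) → WellFormed E → E ≢ [] → Closed E → StructDepIso E
mainTheorem5 E wf _ cl = record
  { φ      = varOf
  ; into   = T-elim E cl (λ t → V (varOf t)) id
  ; inj    = λ tT uT → T-elim E cl (λ t → ∀ {u} → T u → varOf t ≡ varOf u → t ≡ u)
               (λ _ → T-elim E cl (λ u → _ ≡ varOf u → _ ≡ u) (λ _ → cong ′_)) tT uT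
  ; surj   = λ {X} bound → ′ X , (X , bound , ε) , refl
  ; edges  = λ tT uT → T-elim E cl (λ t → ∀ {u} → T u → t ⟶ u ⇔ varOf t ⇒ varOf u)
               (λ _ → T-elim E cl (λ u → _ ⟶ u ⇔ _ ⇒ varOf u) (λ _ → edge-iff E)) tT uT
  ; deco▲  = T-elim E cl (λ t → d t ▲ ⇔ l (varOf t) ≡ ∧ₗ) (λ _ → conj-iff E wf)
  ; deco▼  = T-elim E cl (λ t → d t ▼ ⇔ l (varOf t) ≡ ∨ₗ) (λ _ → disj-iff E wf)
  ; decoRk = T-elim E cl (λ t → ∀ n → d t (rk n) ⇔ r (varOf t) ≡ n) (rank-iff E)
  }
  where
  open StructureGraph E
  open DependencyGraph E
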